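{- Let $n\geq 2$, $k\geq 1$, $a=2[n,n+1,\ldots,n+k]$, $b=L_nL_{n+1}\cdots L_{n+k}$ and $f_k(n)=\frac{L_nL_{n+1}\cdots L_{n+k}}{[L_n,L_{n+1},\ldots,L_{n+k}]}$. Then: (i) $b\mid f_k(n)F_{aj}$ for every integer $j\geq 1$. (ii) $z(b)=aj$ where $j$ is the smallest positive integer such that $b\mid F_{aj}$. In fact, $j$ is the smallest positive integer such that $v_p(b)\le v_p(F_{aj})$ for every prime $p$ dividing $f_k(n)$.
   Context: $F_n$ is the $n$th Fibonacci number ($F_1=F_2=1$, $F_n=F_{n-1}+F_{n-2}$) and $L_n$ the $n$th Lucas number ($L_1=1$, $L_2=3$, $L_n=L_{n-1}+L_{n-2}$). For a positive integer $m$, $z(m)$ is the smallest positive integer $k$ with $m\mid F_k$. $[\cdots]$ denotes lcm and $v_p$ the $p$-adic valuation. -}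

module Defs where

open import Data.Nat using (ℕ; zero; suc; _+_; _*_; _<_; _≤_)
open import Data.Nat.DivMod using (_/_)
open import Data.Nat.Divisibility using (_∣_; _∣?_)
open import Data.Nat.LCM using (lcm)
open import Data.List using (List; map; foldr; upTo)
open import Data.Product using (_×_)
open import Relation.Nullary using (yes; no)

F : ℕ → ℕ
F zero = 0
F (suc zero) = 1
F (suc (suc n)) = F (suc n) + F n

L : ℕ → ℕ
L zero = 2
L (suc zero) = 1
L (suc (suc n)) = L (suc n) + L n

lcmList : List ℕ → ℕ
lcmList = foldr lcm 1

range : ℕ → ℕ → List ℕ
range n k = map (n +_) (upTo (suc k))

-- p-adic valuation v_p(m) for m ≥ 1 (fuel-bounded; v_p(0) := 0 and
-- v_p(m) := 0 for p ≤ 1 are conventions never used in the statement)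
valAux : ℕ → ℕ → ℕ → ℕ
valAux zero p m = 0
valAux (suc fuel) zero m = 0
valAux (suc fuel) (suc zero) m = 0
valAux (suc fuel) (suc (suc q)) zero = 0
valAux (suc fuel) (suc (suc q)) (suc m) with suc (suc q) ∣? suc m
... | yes _ = suc (valAux fuel (suc (suc q)) (suc m / suc (suc q)))
... | no _ = 0

v : ℕ → ℕ → ℕ
v p m = valAux m p m

IsLeastPos : (ℕ → Set) → ℕ → Set
IsLeastPos P m = (0 < m) × P m × (∀ m' → 0 < m' → P m' → m ≤ m')

IsZ : ℕ → ℕ → Set
IsZ m t = IsLeastPos (λ k → m ∣ F k) t

{-# OPTIONS --safe #-}
-- Since L m ∣ F (2m), the lcm of the Lucas numbers divides every F (a j); this gives (i), and it
-- also supplies the full power of every prime not dividing fk, so b ∣ F (a j) is decided by the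
-- valuations at the primes of fk (iii). Conversely, for m ≥ 2 the indices t with L m ∣ F t are
-- exactly the multiples of 2m: they are closed under subtraction (addition formula and
-- gcd (F u, F (u+1)) = 1), and no 0 < r ≤ m qualifies because 0 < F r ≤ F m < L m. Hence every t
-- with b ∣ F t is a multiple of a, and such t exist because the residue pairs (F i, F (i+1))
-- modulo b must repeat.
module Submission where

open import Defs
open import Data.Nat using (ℕ; zero; suc; _+_; _*_; _∸_; _^_; _≤_; _<_; z≤n; s≤s; NonZero; >-nonZero; >-nonZero⁻¹; nonTrivial⇒n>1; _%_; _/_; _≤?_; _<?_)
open import Data.Nat.Properties
open import Data.Nat.Divisibility
open import Data.Nat.DivMod using (_mod_; m≡m%n+[m/n]*n; m%n<n; m≥n⇒m/n>0; m/n<m; %-distribˡ-+; [m+kn]%n≡m%n)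
open import Data.Nat.Coprimality using (Coprime; coprime-divisor)
open import Data.Nat.Induction using (<-rec)
open import Data.Nat.LCM using (m∣lcm[m,n]; n∣lcm[m,n]; lcm-least)
open import Data.Nat.Primality using (Prime; euclidsLemma; prime⇒nonZero; prime⇒nonTrivial)
open import Data.Nat.Primality.Factorisation using (factorise)
open import Data.Nat.ListAction using (product)
open import Data.Nat.ListAction.Properties using (∈⇒∣product; product≢0)
open import Data.Nat.Tactic.RingSolver using (solve-∀)
open import Data.Fin using (Fin; toℕ; combine)
open import Data.Fin.Properties using (pigeonhole; combine-injective; toℕ-fromℕ<)
open import Data.List using (List; []; _∷_; map)
open import Data.List.Membership.Propositional using (_∈_)
open import Data.List.Membership.Propositional.Properties using (∈-map⁻; ∈-map⁺)
open import Data.List.Relation.Unary.Any using (here; there)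
open import Data.List.Relation.Unary.All using (_∷_; universal)
open import Data.List.Relation.Unary.All.Properties using (map⁺)
open import Data.Product using (_×_; _,_; ∃; ∃-syntax)
open import Data.Sum using (inj₁; inj₂)
open import Function.Bundles using (_⇔_; mk⇔; Equivalence)
open import Function using (_∘_)
open import Relation.Nullary using (¬_; yes; no; contradiction)
open import Relation.Nullary.Decidable using (_×-dec_)
open import Relation.Unary using (Decidable)
open import Relation.Binary.PropositionalEquality

*-pos : ∀ {m n} → 0 < m → 0 < n → 0 < m * n
*-pos (s≤s z≤n) (s≤s z≤n) = s≤s z≤n

∣-pos : ∀ {c m} → 0 < m → c ∣ m → 0 < c
∣-pos {zero} m>0 0∣m = contradiction (0∣⇒≡0 0∣m) (≢-sym (<⇒≢ m>0))
∣-pos {suc c} _ _ = s≤s z≤n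

2*m≡m+m : ∀ m → 2 * m ≡ m + m
2*m≡m+m m = cong (m +_) (+-identityʳ m)

F-addition : ∀ m n → F (suc (m + n)) ≡ F (suc m) * F (suc n) + F m * F n
F-addition zero n = sym (trans (+-identityʳ _) (*-identityˡ _))
F-addition (suc m) n = begin
    F (suc (suc (m + n)))
  ≡⟨ cong (λ s → F (suc s)) (sym (+-suc m n)) ⟩
    F (suc (m + suc n))
  ≡⟨ F-addition m (suc n) ⟩
    F (suc m) * (F (suc n) + F n) + F m * F (suc n)
  ≡⟨ regroup (F (suc m)) (F m) (F (suc n)) (F n) ⟩
    (F (suc m) + F m) * F (suc n) + F (suc m) * F n
  ∎
  where
  open ≡-Reasoning
  regroup : ∀ a d b c → a * (b + c) + d * b ≡ (a + d) * b + a * c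
  regroup = solve-∀

F∣F[q*d] : ∀ d q → F d ∣ F (q * d)
F∣F[q*d] d zero = F d ∣0
F∣F[q*d] zero (suc q) = subst (λ s → 0 ∣ F s) (sym (*-zeroʳ q)) ∣-refl
F∣F[q*d] (suc d) (suc q) = subst (F (suc d) ∣_) (sym (F-addition d (q * suc d)))
  (∣m∣n⇒∣m+n (∣m⇒∣m*n _ ∣-refl) (∣n⇒∣m*n (F d) (F∣F[q*d] (suc d) q)))

∣⇒F∣F : ∀ {d t} → d ∣ t → F d ∣ F t
∣⇒F∣F {d} (divides q refl) = F∣F[q*d] d q

L≡F+F : ∀ m → L (suc m) ≡ F m + F (suc (suc m))
L≡F+F zero = refl
L≡F+F (suc zero) = refl
L≡F+F (suc (suc m)) = begin
    L (suc (suc m)) + L (suc m)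
  ≡⟨ cong₂ _+_ (L≡F+F (suc m)) (L≡F+F m) ⟩
    (F (suc m) + F (suc (suc (suc m)))) + (F m + F (suc (suc m)))
  ≡⟨ regroup (F (suc m)) (F m) (F (suc (suc m))) (F (suc (suc (suc m)))) ⟩
    (F (suc m) + F m) + (F (suc (suc (suc m))) + F (suc (suc m)))
  ∎
  where
  open ≡-Reasoning
  regroup : ∀ a b c d → (a + d) + (b + c) ≡ (a + b) + (d + c)
  regroup = solve-∀

L-pos : ∀ n → 0 < L n
L-pos zero = s≤s z≤n
L-pos (suc zero) = s≤s z≤n
L-pos (suc (suc n)) = ≤-trans (L-pos (suc n)) (m≤m+n _ _)

F[m+m]≡F[m]*L[m] : ∀ m → F (m + m) ≡ F m * L m
F[m+m]≡F[m]*L[m] zero = refl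
F[m+m]≡F[m]*L[m] (suc m) = begin
    F (suc (m + suc m))
  ≡⟨ F-addition m (suc m) ⟩
    F (suc m) * F (suc (suc m)) + F m * F (suc m)
  ≡⟨ regroup (F (suc m)) (F m) (F (suc (suc m))) ⟩
    F (suc m) * (F m + F (suc (suc m)))
  ≡⟨ cong (F (suc m) *_) (sym (L≡F+F m)) ⟩
    F (suc m) * L (suc m)
  ∎
  where
  open ≡-Reasoning
  regroup : ∀ a b c → a * c + b * a ≡ a * (b + c)
  regroup = solve-∀

L∣F[m+m] : ∀ m → L m ∣ F (m + m)
L∣F[m+m] m = divides (F m) (F[m+m]≡F[m]*L[m] m)

F-coprime-suc : ∀ n → Coprime (F n) (F (suc n))
F-coprime-suc zero (_ , d∣1) = ∣1⇒≡1 d∣1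
F-coprime-suc (suc n) (d∣F[1+n] , d∣F[2+n]) =
  F-coprime-suc n (∣m+n∣m⇒∣n d∣F[2+n] d∣F[1+n] , d∣F[1+n])

∣F∧∣F[m+r]⇒∣F : ∀ {d} m r → d ∣ F m → d ∣ F (m + r) → d ∣ F r
∣F∧∣F[m+r]⇒∣F zero r _ d∣F[r] = d∣F[r]
∣F∧∣F[m+r]⇒∣F {d} (suc u) r d∣F[1+u] d∣F[1+u+r] = coprime-divisor d⊥F[u]
  (∣m+n∣m⇒∣n (subst (d ∣_) (F-addition u r) d∣F[1+u+r]) (∣m⇒∣m*n _ d∣F[1+u]))
  where
  d⊥F[u] : Coprime d (F u)
  d⊥F[u] (c∣d , c∣F[u]) = F-coprime-suc u (c∣F[u] , ∣-trans c∣d d∣F[1+u])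

∣F∧∣F[r+q*m]⇒∣F : ∀ {d} m q r → d ∣ F m → d ∣ F (r + q * m) → d ∣ F r
∣F∧∣F[r+q*m]⇒∣F m zero r _ d∣F = subst (λ s → _ ∣ F s) (+-identityʳ r) d∣F
∣F∧∣F[r+q*m]⇒∣F {d} m (suc q) r d∣F[m] d∣F =
  ∣F∧∣F[r+q*m]⇒∣F m q r d∣F[m] (∣F∧∣F[m+r]⇒∣F m (r + q * m) d∣F[m]
    (subst (λ s → d ∣ F s) (+-comm-middle r m (q * m)) d∣F))
  where
  +-comm-middle : ∀ x y z → x + (y + z) ≡ y + (x + z)
  +-comm-middle = solve-∀

∣F⇒∣F[%] : ∀ {d} m .{{_ : NonZero m}} t → d ∣ F m → d ∣ F t → d ∣ F (t % m)
∣F⇒∣F[%] m t d∣F[m] d∣F[t] = ∣F∧∣F[r+q*m]⇒∣F m (t / m) (t % m) d∣F[m]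
  (subst (λ s → _ ∣ F s) (m≡m%n+[m/n]*n t m) d∣F[t])

F≤F[1+n] : ∀ n → F n ≤ F (suc n)
F≤F[1+n] zero = z≤n
F≤F[1+n] (suc n) = m≤m+n _ _

F-mono-≤ : ∀ {m n} → m ≤ n → F m ≤ F n
F-mono-≤ {m} m≤n with m≤n⇒∃[o]m+o≡n m≤n
... | o , refl = go o
  where
  go : ∀ o → F m ≤ F (m + o)
  go zero = ≤-reflexive (cong F (sym (+-identityʳ m)))
  go (suc o) = ≤-trans (go o) (subst (λ s → F (m + o) ≤ F s) (sym (+-suc m o)) (F≤F[1+n] (m + o)))

F-pos : ∀ {n} → 0 < n → 0 < F n
F-pos {suc zero} _ = s≤s z≤n
F-pos {suc (suc n)} _ = ≤-trans (F-pos {suc n} (s≤s z≤n)) (F≤F[1+n] (suc n))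

F<L : ∀ m → F (suc (suc m)) < L (suc (suc m))
F<L m = subst (F (suc (suc m)) <_) (sym (L≡F+F (suc m)))
  (≤-trans (s≤s (F≤F[1+n] (suc (suc m)))) (+-monoˡ-≤ _ (F-pos {suc m} (s≤s z≤n))))

L∤F : ∀ {m r} → 2 ≤ m → 0 < r → r ≤ m → ¬ L m ∣ F r
L∤F {suc (suc m)} {suc r} (s≤s (s≤s z≤n)) (s≤s z≤n) r≤m L∣F =
  <⇒≱ (F<L m) (≤-trans (∣⇒≤ {{>-nonZero (F-pos {suc r} (s≤s z≤n))}} L∣F) (F-mono-≤ r≤m))

L∣F∧<[m+m]⇒≡0 : ∀ {m r} → 2 ≤ m → r < m + m → L m ∣ F r → r ≡ 0
L∣F∧<[m+m]⇒≡0 {r = zero} _ _ _ = refl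
L∣F∧<[m+m]⇒≡0 {m} {r@(suc _)} m≥2 r<2m L∣F[r] with r ≤? m
... | yes r≤m = contradiction L∣F[r] (L∤F m≥2 (s≤s z≤n) r≤m)
... | no r≰m = contradiction L∣F[s] (L∤F m≥2 (m<n⇒0<n∸m r<2m) s≤m)
  where
  s = (m + m) ∸ r
  L∣F[s] : L m ∣ F s
  L∣F[s] = ∣F∧∣F[m+r]⇒∣F r s L∣F[r]
    (subst (λ t → L m ∣ F t) (sym (m+[n∸m]≡n (<⇒≤ r<2m))) (L∣F[m+m] m))
  s≤m : s ≤ m
  s≤m = ≤-trans (∸-monoʳ-≤ (m + m) (<⇒≤ (≰⇒> r≰m))) (≤-reflexive (m+n∸m≡n m m))

L∣F⇒2*m∣ : ∀ {m t} → 2 ≤ m → L m ∣ F t → 2 * m ∣ t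
L∣F⇒2*m∣ {m@(suc _)} {t} m≥2 L∣F[t] = subst (_∣ t) (sym (2*m≡m+m m))
  (m%n≡0⇒n∣m t (m + m) (L∣F∧<[m+m]⇒≡0 m≥2 (m%n<n t (m + m))
    (∣F⇒∣F[%] (m + m) t (L∣F[m+m] m) L∣F[t])))

%-cong-+ : ∀ {N} .{{_ : NonZero N}} {x x′ y y′} →
           x % N ≡ x′ % N → y % N ≡ y′ % N → (x + y) % N ≡ (x′ + y′) % N
%-cong-+ {N} {x} {x′} {y} {y′} x≡x′ y≡y′ = begin
    (x + y) % N
  ≡⟨ %-distribˡ-+ x y N ⟩
    (x % N + y % N) % N
  ≡⟨ cong₂ (λ u w → (u + w) % N) x≡x′ y≡y′ ⟩
    (x′ % N + y′ % N) % N
  ≡⟨ %-distribˡ-+ x′ y′ N ⟨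
    (x′ + y′) % N
  ∎
  where open ≡-Reasoning

%-cancelˡ-+ : ∀ {N} .{{_ : NonZero N}} {x x′ y y′} →
              x % N ≡ x′ % N → (x + y) % N ≡ (x′ + y′) % N → y % N ≡ y′ % N
%-cancelˡ-+ {N@(suc m)} {x} {x′} {y} {y′} x≡x′ x+y≡x′+y′ = begin
    y % N
  ≡⟨ add-multiple y ⟩
    (m * x + (x + y)) % N
  ≡⟨ %-cong-+ {x = m * x} {m * x} {x + y} {x + y′} refl
       (trans x+y≡x′+y′ (%-cong-+ {x = x′} {x} {y′} {y′} (sym x≡x′) refl)) ⟩
    (m * x + (x + y′)) % N
  ≡⟨ add-multiple y′ ⟨
    y′ % N
  ∎
  where
  open ≡-Reasoning
  -- m * x + x is a multiple of N, so adding m * x on the left cancels x.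
  regroup : ∀ m x z → z + x * suc m ≡ m * x + (x + z)
  regroup = solve-∀
  add-multiple : ∀ z → z % N ≡ (m * x + (x + z)) % N
  add-multiple z = trans (sym ([m+kn]%n≡m%n z x N)) (cong (_% N) (regroup m x z))

F-residues-repeat⇒∣F : ∀ {N} .{{_ : NonZero N}} i d →
  F (i + d) % N ≡ F i % N → F (suc (i + d)) % N ≡ F (suc i) % N → N ∣ F d
F-residues-repeat⇒∣F {N} zero d F[d]≡F[0] _ = m%n≡0⇒n∣m _ N (trans F[d]≡F[0] (n∣m⇒m%n≡0 0 N (N ∣0)))
F-residues-repeat⇒∣F (suc i) d F[1+i+d]≡ F[2+i+d]≡ =
  F-residues-repeat⇒∣F i d (%-cancelˡ-+ F[1+i+d]≡ F[2+i+d]≡) F[1+i+d]≡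

mod≡⇒%≡ : ∀ {m n N} .{{_ : NonZero N}} → m mod N ≡ n mod N → m % N ≡ n % N
mod≡⇒%≡ {m} {n} {N} m≡n = begin
    m % N              ≡⟨ toℕ-fromℕ< (m%n<n m N) ⟨
    toℕ (m mod N)      ≡⟨ cong toℕ m≡n ⟩
    toℕ (n mod N)      ≡⟨ toℕ-fromℕ< (m%n<n n N) ⟩
    n % N              ∎
  where open ≡-Reasoning

∃F-multiple : ∀ N .{{_ : NonZero N}} → ∃ λ t → 0 < t × N ∣ F t
∃F-multiple N =
  let i , j , i<j , same = pigeonhole (n<1+n (N * N)) residuePair
      same₀ , same₁ = combine-injective (F (toℕ i) mod N) _ (F (toℕ j) mod N) _ same
      d , i+1+d≡j = m≤n⇒∃[o]m+o≡n i<j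
      i+d≡j = trans (+-suc (toℕ i) d) i+1+d≡j
  in suc d , s≤s z≤n , F-residues-repeat⇒∣F (toℕ i) (suc d)
       (trans (cong (λ s → F s % N) i+d≡j) (sym (mod≡⇒%≡ same₀)))
       (trans (cong (λ s → F (suc s) % N) i+d≡j) (sym (mod≡⇒%≡ same₁)))
  where
  residuePair : Fin (suc (N * N)) → Fin (N * N)
  residuePair k = combine (F (toℕ k) mod N) (F (suc (toℕ k)) mod N)

p^valAux∣ : ∀ fuel p m → p ^ valAux fuel p m ∣ m
p^valAux∣ zero p m = 1∣ m
p^valAux∣ (suc fuel) zero m = 1∣ m
p^valAux∣ (suc fuel) (suc zero) m = 1∣ m
p^valAux∣ (suc fuel) (suc (suc q)) zero = 1∣ 0
p^valAux∣ (suc fuel) p@(suc (suc q)) (suc m) with p ∣? suc m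
... | yes p∣m = m∣n/o⇒o*m∣n p∣m (p^valAux∣ fuel p (suc m / p))
... | no _ = 1∣ _

^∣⇒≤valAux : ∀ fuel q e m → 0 < m → m ≤ fuel → suc (suc q) ^ e ∣ m → e ≤ valAux fuel (suc (suc q)) m
^∣⇒≤valAux fuel q zero m _ _ _ = z≤n
^∣⇒≤valAux (suc fuel) q (suc e) (suc m) _ m≤fuel p^e∣m with suc (suc q) ∣? suc m
... | yes p∣m = s≤s (^∣⇒≤valAux fuel q e (suc m / p) (m≥n⇒m/n>0 (∣⇒≤ p∣m))
      (≤-pred (≤-trans (m/n<m (suc m) p (s≤s (s≤s z≤n))) m≤fuel)) (m*n∣o⇒n∣o/m p (p ^ e) p^e∣m))
  where p = suc (suc q)
... | no p∤m = contradiction (∣-trans (m∣m*n (suc (suc q) ^ e)) p^e∣m) p∤m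

^-monoʳ-∣ : ∀ p {a b} → a ≤ b → p ^ a ∣ p ^ b
^-monoʳ-∣ p {a} a≤b with m≤n⇒∃[o]m+o≡n a≤b
... | o , refl = divides (p ^ o) (trans (^-distribˡ-+-* p a o) (*-comm (p ^ a) (p ^ o)))

p^v∣ : ∀ p m → p ^ v p m ∣ m
p^v∣ p m = p^valAux∣ m p m

^∣⇒≤v : ∀ {p e m} → 1 < p → 0 < m → p ^ e ∣ m → e ≤ v p m
^∣⇒≤v {suc (suc q)} {e} {m} (s≤s (s≤s z≤n)) m>0 = ^∣⇒≤valAux m q e m m>0 ≤-refl

v-mono-∣ : ∀ {p c m} → 1 < p → 0 < m → c ∣ m → v p c ≤ v p m
v-mono-∣ {p} {c} p>1 m>0 c∣m = ^∣⇒≤v p>1 m>0 (∣-trans (p^v∣ p c) c∣m)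

p^e∣w*c⇒p^e∣w : ∀ {p c} → Prime p → ¬ p ∣ c → ∀ e w → p ^ e ∣ w * c → p ^ e ∣ w
p^e∣w*c⇒p^e∣w _ _ zero w _ = 1∣ w
p^e∣w*c⇒p^e∣w {p} {c} p-prime p∤c (suc e) w p^[1+e]∣w*c
  with euclidsLemma w c p-prime (∣-trans (m∣m*n (p ^ e)) p^[1+e]∣w*c)
... | inj₂ p∣c = contradiction p∣c p∤c
... | inj₁ (divides w′ refl) = subst (p * p ^ e ∣_) (*-comm p w′)
  (*-monoʳ-∣ p (p^e∣w*c⇒p^e∣w p-prime p∤c e w′
    (*-cancelˡ-∣ p (subst (p * p ^ e ∣_) (regroup w′ p c) p^[1+e]∣w*c))))
  where
  instance _ = prime⇒nonZero p-prime
  regroup : ∀ w′ p c → w′ * p * c ≡ p * (w′ * c)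
  regroup = solve-∀

prime⇒1< : ∀ {p} → Prime p → 1 < p
prime⇒1< {p} p-prime = nonTrivial⇒n>1 p {{prime⇒nonTrivial p-prime}}

∃prime-∣ : ∀ m → 1 < m → ∃[ p ] (Prime p × p ∣ m)
∃prime-∣ (suc (suc x)) (s≤s (s≤s z≤n)) with factorise (suc (suc x))
... | record { factors = p ∷ ps ; isFactorisation = m≡p*ps ; factorsPrime = p-prime ∷ _ } =
  p , p-prime , divides (product ps) (trans m≡p*ps (*-comm p _))

split-prime-power : ∀ {p m} → Prime p → 0 < m → p ∣ m →
  ∃[ c ] (m ≡ c * p ^ v p m × c < m × ¬ p ∣ c)
split-prime-power {p} {m} p-prime m>0 p∣m with p^v∣ p m
... | divides c m≡c*p^e = c , m≡c*p^e , c<m , p∤c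
  where
  instance _ = prime⇒nonZero p-prime
  e = v p m
  c>0 : 0 < c
  c>0 = ∣-pos m>0 (divides (p ^ e) (trans m≡c*p^e (*-comm c (p ^ e))))
  1<p^e : 1 < p ^ e
  1<p^e = ≤-trans (prime⇒1< p-prime) (≤-trans (≤-reflexive (sym (*-identityʳ p)))
    (^-monoʳ-≤ p {1} {e} (^∣⇒≤v (prime⇒1< p-prime) m>0 (subst (_∣ m) (sym (*-identityʳ p)) p∣m))))
  c<m : c < m
  c<m = subst (c <_) (sym m≡c*p^e) (m<m*n c (p ^ e) {{>-nonZero c>0}} 1<p^e)
  p∤c : ¬ p ∣ c
  p∤c p∣c = <⇒≱ (n<1+n e) (^∣⇒≤v (prime⇒1< p-prime) m>0
    (subst (p * p ^ e ∣_) (sym m≡c*p^e) (*-monoˡ-∣ (p ^ e) p∣c)))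

c∣∧p^e∣⇒c*p^e∣ : ∀ {p c e N} → Prime p → ¬ p ∣ c → c ∣ N → p ^ e ∣ N → c * p ^ e ∣ N
c∣∧p^e∣⇒c*p^e∣ {p} {c} {e} p-prime p∤c (divides w refl) p^e∣w*c =
  subst (c * p ^ e ∣_) (*-comm c w) (*-monoʳ-∣ c (p^e∣w*c⇒p^e∣w p-prime p∤c e w p^e∣w*c))

prime-powers-∣⇒∣ : ∀ {N} m → 0 < m → (∀ p → Prime p → p ∣ m → p ^ v p m ∣ N) → m ∣ N
prime-powers-∣⇒∣ {N} = <-rec _ go
  where
  go : ∀ m → (∀ {c} → c < m → 0 < c → (∀ p → Prime p → p ∣ c → p ^ v p c ∣ N) → c ∣ N) →
       0 < m → (∀ p → Prime p → p ∣ m → p ^ v p m ∣ N) → m ∣ N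
  go (suc zero) _ _ _ = 1∣ N
  go m@(suc (suc _)) rec m>0 m-powers∣N with ∃prime-∣ m (s≤s (s≤s z≤n))
  ... | p , p-prime , p∣m with split-prime-power p-prime m>0 p∣m
  ... | c , m≡c*p^e , c<m , p∤c = subst (_∣ N) (sym m≡c*p^e)
    (c∣∧p^e∣⇒c*p^e∣ {e = v p m} p-prime p∤c (rec c<m c>0 c-powers∣N) (m-powers∣N p p-prime p∣m))
    where
    c∣m : c ∣ m
    c∣m = divides (p ^ v p m) (trans m≡c*p^e (*-comm c _))
    c>0 : 0 < c
    c>0 = ∣-pos m>0 c∣m
    c-powers∣N : ∀ q → Prime q → q ∣ c → q ^ v q c ∣ N
    c-powers∣N q q-prime q∣c = ∣-trans (^-monoʳ-∣ q (v-mono-∣ (prime⇒1< q-prime) m>0 c∣m))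
      (m-powers∣N q q-prime (∣-trans q∣c c∣m))

leastPos-exists : ∀ {P : ℕ → Set} → Decidable P → ∀ w → 0 < w → P w → ∃ (IsLeastPos P)
leastPos-exists {P} P? = <-rec _ go
  where
  go : ∀ w → (∀ {i} → i < w → 0 < i → P i → ∃ (IsLeastPos P)) → 0 < w → P w → ∃ (IsLeastPos P)
  go w rec w>0 Pw with anyUpTo? (λ i → 0 <? i ×-dec P? i) w
  ... | yes (i , i<w , i>0 , Pi) = rec i<w i>0 Pi
  ... | no none = w , w>0 , Pw , λ i i>0 Pi → ≮⇒≥ (λ i<w → none (i , i<w , i>0 , Pi))

IsLeastPos-cong : ∀ {P Q : ℕ → Set} → (∀ {i} → 0 < i → P i ⇔ Q i) → ∀ j → IsLeastPos P j ⇔ IsLeastPos Q j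
IsLeastPos-cong P⇔Q j = mk⇔ (transport (λ i>0 → to (P⇔Q i>0)) (λ i>0 → from (P⇔Q i>0)))
                            (transport (λ i>0 → from (P⇔Q i>0)) (λ i>0 → to (P⇔Q i>0)))
  where
  open Equivalence
  transport : ∀ {A B : ℕ → Set} → (∀ {i} → 0 < i → A i → B i) → (∀ {i} → 0 < i → B i → A i) →
              IsLeastPos A j → IsLeastPos B j
  transport A⇒B B⇒A (j>0 , Aj , least) = j>0 , A⇒B j>0 Aj , λ i i>0 Bi → least i i>0 (B⇒A i>0 Bi)

leastPos-multiples : ∀ {P : ℕ → Set} {a j} → 0 < a → (∀ {t} → 0 < t → P t → a ∣ t) →
                     IsLeastPos (λ i → P (a * i)) j → IsLeastPos P (a * j)
leastPos-multiples {P} {a} {j} (s≤s z≤n) P⇒a∣ (s≤s z≤n , Paj , least) = s≤s z≤n , Paj , a*j≤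
  where
  a*j≤ : ∀ t → 0 < t → P t → a * j ≤ t
  a*j≤ t t>0 Pt with P⇒a∣ t>0 Pt
  ... | divides i refl = subst (a * j ≤_) (*-comm a i)
        (*-monoʳ-≤ a (least i (∣-pos t>0 (divides a (*-comm i a))) (subst P (*-comm i a) Pt)))

∈⇒∣lcmList : ∀ {x xs} → x ∈ xs → x ∣ lcmList xs
∈⇒∣lcmList {x} {.x ∷ xs} (here refl) = m∣lcm[m,n] x (lcmList xs)
∈⇒∣lcmList {x} {y ∷ xs} (there x∈xs) = ∣-trans (∈⇒∣lcmList x∈xs) (n∣lcm[m,n] y (lcmList xs))

lcmList-least : ∀ {N} xs → (∀ {x} → x ∈ xs → x ∣ N) → lcmList xs ∣ N
lcmList-least [] _ = 1∣ _
lcmList-least (x ∷ xs) xs∣N = lcm-least (xs∣N (here refl)) (lcmList-least xs (xs∣N ∘ there))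

module LucasProduct (R : List ℕ) where

  a b : ℕ
  a = 2 * lcmList R
  b = product (map L R)

  instance
    b-nonZero : NonZero b
    b-nonZero = product≢0 (map⁺ (universal (λ m → >-nonZero (L-pos m)) R))

  lcmList-L∣F[a*j] : ∀ j → lcmList (map L R) ∣ F (a * j)
  lcmList-L∣F[a*j] j = lcmList-least (map L R) L∣F
    where
    L∣F : ∀ {x} → x ∈ map L R → x ∣ F (a * j)
    L∣F x∈LR with ∈-map⁻ L x∈LR
    ... | m , m∈R , refl = ∣-trans (L∣F[m+m] m) (∣⇒F∣F (∣-trans m+m∣a (m∣m*n j)))
      where
      m+m∣a : m + m ∣ a
      m+m∣a = subst (_∣ a) (2*m≡m+m m) (*-monoʳ-∣ 2 (∈⇒∣lcmList m∈R))

  module _ (fk : ℕ) (fk*lcm≡b : fk * lcmList (map L R) ≡ b) where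

    b∣fk*F[a*j] : ∀ j → b ∣ fk * F (a * j)
    b∣fk*F[a*j] j = subst (_∣ fk * F (a * j)) fk*lcm≡b (*-monoʳ-∣ fk (lcmList-L∣F[a*j] j))

    b∣F⇔valuations : ∀ {i} → 0 < a → 0 < i →
      b ∣ F (a * i) ⇔ (∀ p → Prime p → p ∣ fk → v p b ≤ v p (F (a * i)))
    b∣F⇔valuations {i} a>0 i>0 = mk⇔
      (λ b∣F p p-prime _ → v-mono-∣ (prime⇒1< p-prime) F>0 b∣F)
      (λ v≤v → prime-powers-∣⇒∣ b (>-nonZero⁻¹ b) (p^v[b]∣F v≤v))
      where
      F>0 : 0 < F (a * i)
      F>0 = F-pos (*-pos a>0 i>0)
      p^v[b]∣F : (∀ p → Prime p → p ∣ fk → v p b ≤ v p (F (a * i))) →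
                 ∀ p → Prime p → p ∣ b → p ^ v p b ∣ F (a * i)
      p^v[b]∣F v≤v p p-prime _ with p ∣? fk
      ... | yes p∣fk = ∣-trans (^-monoʳ-∣ p (v≤v p p-prime p∣fk)) (p^v∣ p (F (a * i)))
      ... | no p∤fk = ∣-trans (p^e∣w*c⇒p^e∣w p-prime p∤fk (v p b) (lcmList (map L R))
              (subst (p ^ v p b ∣_) (trans (sym fk*lcm≡b) (*-comm fk _)) (p^v∣ p b)))
            (lcmList-L∣F[a*j] i)

  module _ {n} (n∈R : n ∈ R) (R≥2 : ∀ {m} → m ∈ R → 2 ≤ m) where

    b∣F⇒2*m∣ : ∀ {m t} → m ∈ R → b ∣ F t → 2 * m ∣ t
    b∣F⇒2*m∣ m∈R b∣F[t] = L∣F⇒2*m∣ (R≥2 m∈R) (∣-trans (∈⇒∣product (∈-map⁺ L m∈R)) b∣F[t])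

    b∣F⇒a∣ : ∀ {t} → b ∣ F t → a ∣ t
    b∣F⇒a∣ {t} b∣F[t] with ∣-trans {2} {2 * n} {t} (divides n (*-comm 2 n)) (b∣F⇒2*m∣ n∈R b∣F[t])
    ... | divides t′ refl = subst (a ∣_) (*-comm 2 t′) (*-monoʳ-∣ 2 (lcmList-least R m∣t′))
      where
      m∣t′ : ∀ {m} → m ∈ R → m ∣ t′
      m∣t′ {m} m∈R = *-cancelˡ-∣ 2 (subst (2 * m ∣_) (*-comm t′ 2) (b∣F⇒2*m∣ m∈R b∣F[t]))

    a-pos : 0 < a
    a-pos = let t , t>0 , b∣F[t] = ∃F-multiple b in ∣-pos t>0 (b∣F⇒a∣ b∣F[t])

    ∃leastPos : ∃ (IsLeastPos (λ i → b ∣ F (a * i)))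
    ∃leastPos with ∃F-multiple b
    ... | t , t>0 , b∣F[t] with b∣F⇒a∣ {t} b∣F[t]
    ... | divides q refl = leastPos-exists (λ i → b ∣? F (a * i)) q (∣-pos t>0 (divides a (*-comm q a)))
      (subst (λ s → b ∣ F s) (*-comm q a) b∣F[t])

    z[b]≡a*j : ∀ {j} → IsLeastPos (λ i → b ∣ F (a * i)) j → IsZ b (a * j)
    z[b]≡a*j = leastPos-multiples a-pos (λ _ → b∣F⇒a∣)

theorem4p4 : (n k : ℕ) → 2 ≤ n → 1 ≤ k →
    let a = 2 * lcmList (range n k)
        b = product (map L (range n k))
    in (fk : ℕ) → fk * lcmList (map L (range n k)) ≡ b →
       (∀ j → 1 ≤ j → b ∣ fk * F (a * j))
       × (∃[ j ] (IsLeastPos (λ i → b ∣ F (a * i)) j × IsZ b (a * j)))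
       × (∀ j → IsLeastPos (λ i → b ∣ F (a * i)) j
                ⇔ IsLeastPos (λ i → ∀ p → Prime p → p ∣ fk → v p b ≤ v p (F (a * i))) j)
theorem4p4 n k n≥2 _ fk fk*lcm≡b =
  let j , j-least = ∃leastPos n∈R R≥2
  in (λ i _ → b∣fk*F[a*j] fk fk*lcm≡b i) ,
     (j , j-least , z[b]≡a*j n∈R R≥2 j-least) ,
     IsLeastPos-cong (b∣F⇔valuations fk fk*lcm≡b (a-pos n∈R R≥2))
  where
  open LucasProduct (range n k)
  n∈R : n ∈ range n k
  n∈R = here (sym (+-identityʳ n))
  R≥2 : ∀ {m} → m ∈ range n k → 2 ≤ m
  R≥2 m∈R with ∈-map⁻ (n +_) m∈R
  ... | i , _ , refl = ≤-trans n≥2 (m≤m+n n i)
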